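{- Let $N$ be a network of comparators (each layer a partition of the positions into comparators of arbitrary sizes, applied as below) on arrays of length $n$. If the input to $N$ is an $s$-sorted $0/1$-array with unsorted interval $I$, then the output of $N$ is also $s$-sorted with $I$ as an unsorted interval.
   Context: A comparator on index set $S$ sorts the values at positions in $S$ in non-decreasing order and writes them back into positions of $S$ in increasing index order. A $0/1$-array $A$ of length $n$ is $s$-sorted if there is an integer interval $I=\{i,\dots,i+s-1\}\subseteq\{1,\dots,n\}$ such that $A[j]=0$ for all $j<i$ and $A[j]=1$ for all $j\ge i+s$; such $I$ is called an unsorted interval. -}

module Defs where

open import Data.Nat using (ℕ; zero; suc; _+_; _≤_; _<_)
open import Data.Nat.Properties using (≤-decTotalOrder; _≟_)
open import Data.Fin using (Fin; toℕ) renaming (_<?_ to _<ᶠ?_)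
open import Data.List using (List; []; _∷_; map; filter; length; allFin)
open import Data.Product using (Σ; _×_)
open import Relation.Binary.PropositionalEquality using (_≡_)
import Data.List.Sort

open Data.List.Sort ≤-decTotalOrder using (sort)

Array : ℕ → Set
Array n = Fin n → ℕ

ZeroOne : ∀ {n} → Array n → Set
ZeroOne {n} A = (j : Fin n) → A j ≤ 1

-- k-th element of a list (0-based); default 0 (never used out of range).
nth : List ℕ → ℕ → ℕ
nth []       _       = 0
nth (x ∷ xs) zero    = x
nth (x ∷ xs) (suc k) = nth xs k

-- A layer is a partition of the positions into comparators, given by a
-- block label for each position: the comparator containing position j is
-- the set S = { i | label i = label j } (arbitrary sizes allowed).
Layer : ℕ → Set
Layer n = Fin n → ℕ

block : ∀ {n} → Layer n → Fin n → List (Fin n)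
block {n} L j = filter (λ i → L i ≟ L j) (allFin n)

-- Applying a layer: every comparator S sorts the values at positions of S
-- in non-decreasing order and writes them back into the positions of S in
-- increasing index order. Position j, being the r-th element of S
-- (r = number of positions of S before j), receives the r-th smallest value.
applyLayer : ∀ {n} → Layer n → Array n → Array n
applyLayer L A j =
  nth (sort (map A (block L j)))
      (length (filter (λ i → i <ᶠ? j) (block L j)))

Network : ℕ → Set
Network n = List (Layer n)

run : ∀ {n} → Network n → Array n → Array n
run []       A = A
run (L ∷ Ls) A = run Ls (applyLayer L A)

-- I = {i, …, i+s-1} (0-based positions) is an unsorted interval of A
-- (I ⊆ positions, zeros before I, ones after I).
UnsortedInterval : ∀ {n} → Array n → (s i : ℕ) → Set
UnsortedInterval {n} A s i =
  (i + s ≤ n)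
  × ((j : Fin n) → toℕ j < i → A j ≡ 0)
  × ((j : Fin n) → i + s ≤ toℕ j → A j ≡ 1)

SSorted : ∀ {n} → Array n → ℕ → Set
SSorted A s = Σ ℕ (λ i → UnsortedInterval A s i)

{-# OPTIONS --safe #-}
-- A comparator places the value it writes to position j at rank r in its
-- block, where r counts the block positions before j.  If every position up
-- to j holds a value ≤ v, then at least r + 1 values of the block are ≤ v, so
-- the r-th smallest is ≤ v; dually, if every position from j on holds a value
-- ≥ v, then at least (block size − r) values are ≥ v, so the r-th smallest is
-- ≥ v.  Hence a layer keeps the zeros before I and the ones after I; the 0/1
-- hypothesis is needed only to turn "≥ 1" into "= 1".
module Submission where

open import Defs
open import Data.Nat using (ℕ; zero; suc; _+_; _≤_; _<_; _≤?_; _<?_; _≟_; z≤n; s≤s; s≤s⁻¹)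
open import Data.Nat.Properties
  using (≤-decTotalOrder; ≤-refl; ≤-reflexive; ≤-trans; ≤-antisym; <⇒≤; <-irrefl; ≤-<-trans;
         ≮⇒≥; m≤n⇒m≤1+n; n≤1+n; +-monoʳ-≤; +-suc; n≤0⇒n≡0)
open import Data.Fin using (Fin; toℕ) renaming (_<?_ to _<ᶠ?_)
open import Data.List using (List; []; _∷_; map; filter; length)
open import Data.List.Properties using (length-map; length-filter; filter-accept; filter-reject; filter-none; filter-notAll)
open import Data.List.Membership.Propositional using (_∈_)
open import Data.List.Membership.Propositional.Properties using (∈-filter⁺; ∈-allFin)
open import Data.List.Relation.Unary.All as All using (All; _∷_)
open import Data.List.Relation.Unary.Any as Any using (here; there)
open import Data.List.Relation.Unary.Linked as Linked using (Linked)
open import Data.List.Relation.Unary.Linked.Properties using (Linked⇒All)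
open import Data.List.Relation.Binary.Permutation.Propositional using (_↭_; ↭-sym)
open import Data.List.Relation.Binary.Permutation.Propositional.Properties
  using (filter-↭; ↭-length)
open import Data.Product using (_×_; _,_)
open import Data.Sum using (_⊎_; inj₁; inj₂)
open import Function using (_∘_)
open import Level using (Level)
open import Relation.Binary.PropositionalEquality using (_≡_; refl; sym; cong; subst; subst₂)
open import Relation.Nullary using (¬_; yes; no; contradiction)
open import Relation.Unary using (Pred; Decidable)
import Data.List.Sort

open Data.List.Sort ≤-decTotalOrder using (sort; sort-↭; sort-↗)

private
  variable
    a p q : Level
    A B : Set a

count : {P : Pred A p} → Decidable P → List A → ℕ
count P? = length ∘ filter P?

module _ {P : Pred A p} {Q : Pred A q} (P? : Decidable P) (Q? : Decidable Q) where

  count-mono : (∀ {x} → P x → Q x) → ∀ xs → count P? xs ≤ count Q? xs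
  count-mono P⊆Q [] = z≤n
  count-mono P⊆Q (x ∷ xs) with P? x | Q? x
  ... | yes _  | yes _  = s≤s (count-mono P⊆Q xs)
  ... | yes Px | no ¬Qx = contradiction (P⊆Q Px) ¬Qx
  ... | no _   | yes _  = m≤n⇒m≤1+n (count-mono P⊆Q xs)
  ... | no _   | no _   = count-mono P⊆Q xs

  count-mono-< : (∀ {x} → P x → Q x) → ∀ {y xs} → y ∈ xs → ¬ P y → Q y →
                 count P? xs < count Q? xs
  count-mono-< P⊆Q {xs = x ∷ xs} (here refl) ¬Px Qx with P? x | Q? x
  ... | yes Px | _      = contradiction Px ¬Px
  ... | no _   | yes _  = s≤s (count-mono P⊆Q xs)
  ... | no _   | no ¬Qx = contradiction Qx ¬Qx
  count-mono-< P⊆Q {xs = x ∷ xs} (there y∈xs) ¬Py Qy with P? x | Q? x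
  ... | yes _  | yes _  = s≤s (count-mono-< P⊆Q y∈xs ¬Py Qy)
  ... | yes Px | no ¬Qx = contradiction (P⊆Q Px) ¬Qx
  ... | no _   | yes _  = m≤n⇒m≤1+n (count-mono-< P⊆Q y∈xs ¬Py Qy)
  ... | no _   | no _   = count-mono-< P⊆Q y∈xs ¬Py Qy

  length≤count+count : (∀ x → P x ⊎ Q x) → ∀ xs → length xs ≤ count P? xs + count Q? xs
  length≤count+count P∪Q [] = z≤n
  length≤count+count P∪Q (x ∷ xs) with P? x | Q? x
  ... | yes _ | yes _ = s≤s (≤-trans (length≤count+count P∪Q xs) (+-monoʳ-≤ (count P? xs) (n≤1+n _)))
  ... | yes _ | no _  = s≤s (length≤count+count P∪Q xs)
  ... | no _  | yes _ =
    ≤-trans (s≤s (length≤count+count P∪Q xs)) (≤-reflexive (sym (+-suc _ _)))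
  ... | no ¬Px | no ¬Qx with P∪Q x
  ...   | inj₁ Px = contradiction Px ¬Px
  ...   | inj₂ Qx = contradiction Qx ¬Qx

module _ {P : Pred A p} (P? : Decidable P) where

  count-accept : ∀ {x xs} → P x → count P? (x ∷ xs) ≡ suc (count P? xs)
  count-accept Px = cong length (filter-accept P? Px)

  count-reject : ∀ {x xs} → ¬ P x → count P? (x ∷ xs) ≡ count P? xs
  count-reject ¬Px = cong length (filter-reject P? ¬Px)

  count-↭ : ∀ {xs ys} → xs ↭ ys → count P? xs ≡ count P? ys
  count-↭ xs↭ys = ↭-length (filter-↭ P? xs↭ys)

  count-map : (f : B → A) → ∀ xs → count P? (map f xs) ≡ count (P? ∘ f) xs
  count-map f [] = refl
  count-map f (x ∷ xs) with P? (f x)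
  ... | yes _ = cong suc (count-map f xs)
  ... | no _ = count-map f xs

nth-All : {P : Pred ℕ p} {xs : List ℕ} (r : ℕ) → All P xs → r < length xs → P (nth xs r)
nth-All zero    (px ∷ _)   _   = px
nth-All (suc r) (_ ∷ pxs) r<n = nth-All r pxs (s≤s⁻¹ r<n)

Sorted : List ℕ → Set
Sorted = Linked _≤_

Sorted⇒All≥head : ∀ {x xs} → Sorted (x ∷ xs) → All (x ≤_) (x ∷ xs)
Sorted⇒All≥head = Linked⇒All ≤-trans ≤-refl

module _ {v : ℕ} where

  sorted-nth-≤ : ∀ {xs} r → Sorted xs → r < count (_≤? v) xs → nth xs r ≤ v
  sorted-nth-≤ {x ∷ xs} r sorted r<c with x ≤? v
  sorted-nth-≤ {x ∷ xs} zero    sorted r<c | yes x≤v = x≤v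
  sorted-nth-≤ {x ∷ xs} (suc r) sorted r<c | yes x≤v =
    sorted-nth-≤ r (Linked.tail sorted) (s≤s⁻¹ (subst (suc r <_) (count-accept (_≤? v) x≤v) r<c))
  sorted-nth-≤ {x ∷ xs} r       sorted r<c | no x≰v =
    contradiction (subst (r <_) noneBelow r<c) λ ()
    where
    noneBelow : count (_≤? v) (x ∷ xs) ≡ 0
    noneBelow = cong length (filter-none (_≤? v)
      (All.map (λ x≤y y≤v → x≰v (≤-trans x≤y y≤v)) (Sorted⇒All≥head sorted)))

  sorted-≥-nth : ∀ {xs} r → Sorted xs → r < length xs →
                 length xs ≤ r + count (v ≤?_) xs → v ≤ nth xs r
  sorted-≥-nth {x ∷ xs} r sorted r<n n≤r+c with v ≤? x
  ... | yes v≤x = nth-All r (All.map (≤-trans v≤x) (Sorted⇒All≥head sorted)) r<n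
  ... | no v≰x with r | subst (λ c → suc (length xs) ≤ r + c) (count-reject (v ≤?_) v≰x) n≤r+c
  ...   | zero  | n≤c   = contradiction (≤-trans n≤c (length-filter (v ≤?_) xs)) (<-irrefl refl)
  ...   | suc r | n≤r+c′ = sorted-≥-nth r (Linked.tail sorted) (s≤s⁻¹ r<n) (s≤s⁻¹ n≤r+c′)

  sort-nth-≤ : ∀ xs r → r < count (_≤? v) xs → nth (sort xs) r ≤ v
  sort-nth-≤ xs r r<c =
    sorted-nth-≤ r (sort-↗ xs) (subst (r <_) (count-↭ (_≤? v) (↭-sym (sort-↭ xs))) r<c)

  sort-≥-nth : ∀ xs r → r < length xs → length xs ≤ r + count (v ≤?_) xs →
               v ≤ nth (sort xs) r
  sort-≥-nth xs r r<n n≤r+c =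
    sorted-≥-nth r (sort-↗ xs) (subst (r <_) (sym length-sort) r<n)
      (subst₂ (λ m c → m ≤ r + c) (sym length-sort) (count-↭ (v ≤?_) (↭-sym (sort-↭ xs))) n≤r+c)
    where
    length-sort : length (sort xs) ≡ length xs
    length-sort = ↭-length (sort-↭ xs)

∈-block : ∀ {n} (L : Layer n) (j : Fin n) → j ∈ block L j
∈-block L j = ∈-filter⁺ (λ i → L i ≟ L j) (∈-allFin j) refl

module _ {n} (L : Layer n) (A : Array n) (j : Fin n) {v : ℕ} where

  private
    S = block L j
    rank = count (_<ᶠ? j) S

  applyLayer-≤ : (∀ i → toℕ i ≤ toℕ j → A i ≤ v) → applyLayer L A j ≤ v
  applyLayer-≤ upTo-j≤v = sort-nth-≤ (map A S) rank
    (subst (rank <_) (sym (count-map (_≤? v) A S))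
      (count-mono-< (_<ᶠ? j) (λ i → A i ≤? v) (λ {i} i<j → upTo-j≤v i (<⇒≤ i<j))
        (∈-block L j) (<-irrefl refl) (upTo-j≤v j ≤-refl)))

  applyLayer-≥ : (∀ i → toℕ j ≤ toℕ i → v ≤ A i) → v ≤ applyLayer L A j
  applyLayer-≥ from-j≥v = sort-≥-nth (map A S) rank
    (subst (rank <_) (sym (length-map A S)) rank<size)
    (subst₂ (λ m c → m ≤ rank + c) (sym (length-map A S)) (sym (count-map (v ≤?_) A S))
      (length≤count+count (_<ᶠ? j) (λ i → v ≤? A i) before-or-≥v S))
    where
    rank<size : rank < length S
    rank<size = filter-notAll (_<ᶠ? j) S (Any.map (λ { refl → <-irrefl refl }) (∈-block L j))

    before-or-≥v : ∀ i → toℕ i < toℕ j ⊎ v ≤ A i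
    before-or-≥v i with toℕ i <? toℕ j
    ... | yes i<j = inj₁ i<j
    ... | no i≮j = inj₂ (from-j≥v i (≮⇒≥ i≮j))

module _ {n} (L : Layer n) {A : Array n} (zeroOne : ZeroOne A) where

  applyLayer-zeroOne : ZeroOne (applyLayer L A)
  applyLayer-zeroOne j = applyLayer-≤ L A j (λ i _ → zeroOne i)

  applyLayer-unsortedInterval : ∀ {s i} → UnsortedInterval A s i →
                                UnsortedInterval (applyLayer L A) s i
  applyLayer-unsortedInterval (fits , zeros , ones) =
    fits ,
    (λ j j<i → n≤0⇒n≡0 (applyLayer-≤ L A j λ k k≤j → ≤-reflexive (zeros k (≤-<-trans k≤j j<i)))) ,
    (λ j i+s≤j → ≤-antisym (applyLayer-zeroOne j)
                (applyLayer-≥ L A j λ k j≤k → ≤-reflexive (sym (ones k (≤-trans i+s≤j j≤k)))))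

run-unsortedInterval : ∀ {n s i} (N : Network n) {A : Array n} → ZeroOne A →
                       UnsortedInterval A s i → UnsortedInterval (run N A) s i
run-unsortedInterval []      _       interval = interval
run-unsortedInterval (L ∷ N) zeroOne interval =
  run-unsortedInterval N (applyLayer-zeroOne L zeroOne) (applyLayer-unsortedInterval L zeroOne interval)

mainTheorem9 : (n s i : ℕ) (N : Network n) (A : Array n) →
    ZeroOne A → UnsortedInterval A s i →
    SSorted (run N A) s × UnsortedInterval (run N A) s i
mainTheorem9 n s i N A zeroOne interval = (i , output) , output
  where
  output : UnsortedInterval (run N A) s i
  output = run-unsortedInterval N zeroOne interval
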